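{- For any structure $\mathcal{A}$ whose Gaifman graph has finite girth, the girth of $\mathrm{pump}(\mathcal{A})$ is strictly greater than the girth of $\mathcal{A}$. Moreover, if $\mathcal{A}$ is finite then $\mathrm{pump}(\mathcal{A})$ is finite.
   Context: Structures are over relational signatures with unary and binary symbols. The Gaifman graph of $\mathcal{A}$ has vertex set $A$ and an (undirected) edge $\{a,b\}$ whenever $a\neq b$ and $(a,b)\in r^{\mathcal{A}}$ or $(b,a)\in r^{\mathcal{A}}$ for some binary symbol $r$; let $E_{\mathcal{A}}$ be its set of edges. The girth of $\mathcal{A}$ is the length of the shortest cycle of its Gaifman graph ($\infty$ if acyclic; self-loops are not cycles). For $f,g:E_{\mathcal{A}}\to\{0,1\}$ and $e\in E_{\mathcal{A}}$, write $f\approx_e g$ if $f,g$ agree on all edges except $e$ and $g(e)=1-f(e)$. The structure $\mathrm{pump}(\mathcal{A})$ has domain $A\times\{0,1\}^{E_{\mathcal{A}}}$ and: $(a,f)\in C^{\mathrm{pump}(\mathcal{A})}$ iff $a\in C^{\mathcal{A}}$, for every unary $C$; for $a_1\neq a_2$, $((a_1,f_1),(a_2,f_2))\in r^{\mathrm{pump}(\mathcal{A})}$ iff $(a_1,a_2)\in r^{\mathcal{A}}$ and $f_1\approx_{\{a_1,a_2\}}f_2$; and $((a,f),(a,f))\in r^{\mathrm{pump}(\mathcal{A})}$ for all $f$ whenever $(a,a)\in r^{\mathcal{A}}$ (no other pairs are in $r^{\mathrm{pump}(\mathcal{A})}$). -}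

module Defs where

open import Data.Nat using (ℕ; zero; suc; _≤_; _<_)
open import Data.Fin using (Fin; zero; suc)
open import Data.Bool using (Bool; not)
open import Data.Product using (Σ; _×_; _,_; ∃)
open import Data.Sum using (_⊎_)
open import Relation.Nullary using (¬_)
open import Relation.Binary.PropositionalEquality using (_≡_; _≢_; refl; sym; trans)
open import Relation.Binary.Structures using (IsEquivalence)

record Structure (U R : Set) : Set₁ where
  field
    Carrier : Set
    unary   : U → Carrier → Set
    binary  : R → Carrier → Carrier → Set

-- Structures whose carrier comes with an equivalence relation (setoid);
-- needed because pump(A) has domain A × {0,1}^{E_A}, whose elements
-- are only determined up to extensional equality of labelings.
record SStructure (U R : Set) : Set₁ where
  field
    Carrier : Set
    _≈_     : Carrier → Carrier → Set
    isEquiv : IsEquivalence _≈_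
    unary   : U → Carrier → Set
    binary  : R → Carrier → Carrier → Set

toS : ∀ {U R} → Structure U R → SStructure U R
toS A = record
  { Carrier = Carrier ; _≈_ = _≡_
  ; isEquiv = record { refl = refl ; sym = sym ; trans = trans }
  ; unary = unary ; binary = binary }
  where open Structure A

module _ {U R : Set} (S : SStructure U R) where
  open SStructure S

  GAdj : Carrier → Carrier → Set
  GAdj x y = ¬ (x ≈ y) × Σ R (λ r → binary r x y ⊎ binary r y x)

sucMod : ∀ {m} → Fin (suc m) → Fin (suc m)
sucMod {zero} zero = zero
sucMod {suc m} zero = suc zero
sucMod {suc m} (suc i) with sucMod {m} i
... | zero  = zero
... | suc j = suc (suc j)

next : ∀ {n} → Fin n → Fin n
next {suc m} i = sucMod i

module _ {U R : Set} (S : SStructure U R) where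
  open SStructure S

  record Cycle (n : ℕ) : Set where
    field
      long     : 3 ≤ n
      vertex   : Fin n → Carrier
      distinct : ∀ i j → vertex i ≈ vertex j → i ≡ j
      adjacent : ∀ i → GAdj S (vertex i) (vertex (next i))

  IsGirth : ℕ → Set
  IsGirth g = Cycle g × (∀ n → n < g → ¬ Cycle n)

  -- the girth is strictly greater than g (possibly ∞): no cycle of
  -- length ≤ g
  GirthGreaterThan : ℕ → Set
  GirthGreaterThan g = ∀ n → n ≤ g → ¬ Cycle n

  IsFinite : Set
  IsFinite = ∃ λ n → Σ (Fin n → Carrier) λ e → ∀ x → ∃ λ i → e i ≈ x

module _ {U R : Set} (A : Structure U R) where
  open Structure A

  private
    Adj : Carrier → Carrier → Set
    Adj = GAdj (toS A)

  -- an element of {0,1}^{E_A}: a labeling of ordered pairs that is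
  -- symmetric on edges; only its values on edges matter (see _≈L_)
  record Labeling : Set where
    field
      lab     : Carrier → Carrier → Bool
      lab-sym : ∀ a b → Adj a b → lab a b ≡ lab b a
  open Labeling public

  _≈L_ : Labeling → Labeling → Set
  f ≈L g = ∀ a b → Adj a b → lab f a b ≡ lab g a b

  SameEdge : Carrier → Carrier → Carrier → Carrier → Set
  SameEdge x y a₁ a₂ = (x ≡ a₁ × y ≡ a₂) ⊎ (x ≡ a₂ × y ≡ a₁)

  FlipAt : Carrier → Carrier → Labeling → Labeling → Set
  FlipAt a₁ a₂ f g =
    (∀ x y → Adj x y → ¬ SameEdge x y a₁ a₂ → lab f x y ≡ lab g x y)
    × lab g a₁ a₂ ≡ not (lab f a₁ a₂)

  private
    _≈P_ : Carrier × Labeling → Carrier × Labeling → Set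
    (a , f) ≈P (b , g) = a ≡ b × f ≈L g

    ≈P-equiv : IsEquivalence _≈P_
    ≈P-equiv = record
      { refl  = refl , λ _ _ _ → refl
      ; sym   = λ { (refl , p) → refl , λ a b e → sym (p a b e) }
      ; trans = λ { (refl , p) (refl , q) → refl , λ a b e → trans (p a b e) (q a b e) } }

  pump : SStructure U R
  pump = record
    { Carrier = Carrier × Labeling
    ; _≈_     = _≈P_
    ; isEquiv = ≈P-equiv
    ; unary   = λ { C (a , f) → unary C a }
    ; binary  = λ { r (a₁ , f₁) (a₂ , f₂) →
                    (a₁ ≢ a₂ × binary r a₁ a₂ × FlipAt a₁ a₂ f₁ f₂)
                  ⊎ (a₁ ≡ a₂ × f₁ ≈L f₂ × binary r a₁ a₁) } }

{-# OPTIONS --safe #-}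
module Submission where

-- An edge of pump(A) projects to an edge {a,b} of A and flips exactly the label of {a,b}.
-- Project a cycle of pump(A) of length n ≤ g to the closed walk a₀ … a_{n-1} a₀ in A.
-- It cannot backtrack: a → b → a flips the same label twice and so returns to the same
-- vertex of pump(A). A non-backtracking walk that revisits a vertex contains a cycle no
-- longer than itself, i.e. shorter than the girth; hence a₀, …, a_{n-1} are distinct.
-- Then the edge {a₀,a₁} is traversed exactly once around the cycle, so its label cannot
-- return to its initial value. For finiteness, a labeling of a finite structure is
-- determined up to ≈L by finitely many bits.

open import Defs
open import Data.Bool using (Bool; not; _∧_)
open import Data.Bool.Properties using (not-involutive; not-¬; ∧-comm; ∧-idem) renaming (_≟_ to _≟ᴮ_)
open import Data.Empty using (⊥-elim)
open import Data.Fin using (Fin; zero; suc; toℕ; combine; remQuot; finToFun; funToFin)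
open import Data.Fin.Properties using (toℕ-injective; toℕ<n; toℕ-fromℕ<; remQuot-combine; finToFun-funToFin; 2↔Bool)
open import Data.Nat using (ℕ; zero; suc; _+_; _*_; _^_; _∸_; _≤_; _<_; z≤n; s≤s)
open import Data.Nat.DivMod using (_%_; _mod_; m<n⇒m%n≡m; n%n≡0; m%n%n≡m%n; %-distribˡ-+)
open import Data.Nat.Properties
  using (≤-refl; ≤-trans; ≤-pred; <⇒≤; ≤-<-trans; <-≤-trans; m≤m+n; m≤n+m; m≤n⇒m≤1+n; m<n⇒m<1+n;
         m≤n⇒m<n∨m≡n; +-monoˡ-≤; +-cancelʳ-≡; m∸n+n≡m; m≢1+n+m)
open import Data.Product using (∃; _×_; _,_; proj₁; proj₂; uncurry)
open import Data.Sum using (_⊎_; inj₁; inj₂; swap)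
open import Function using (_∘_; Inverse)
open import Relation.Nullary using (¬_)
open import Relation.Nullary.Decidable using (decidable-stable)
open import Relation.Binary.PropositionalEquality

toℕ-sucMod : ∀ {m} (i : Fin (suc m)) →
  (toℕ i < m × toℕ (sucMod i) ≡ suc (toℕ i)) ⊎ (toℕ i ≡ m × toℕ (sucMod i) ≡ 0)
toℕ-sucMod {zero}  zero    = inj₂ (refl , refl)
toℕ-sucMod {suc m} zero    = inj₁ (s≤s z≤n , refl)
toℕ-sucMod {suc m} (suc i) with sucMod {m} i | toℕ-sucMod {m} i
... | zero  | inj₂ (i≡m , _)   = inj₂ (cong suc i≡m , refl)
... | suc j | inj₁ (i<m , eq)  = inj₁ (s≤s i<m , cong suc eq)

toℕ-next : ∀ {m} (i : Fin (suc m)) → toℕ (next i) ≡ suc (toℕ i) % suc m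
toℕ-next {m} i with toℕ-sucMod i
... | inj₁ (i<m , eq)  = trans eq (sym (m<n⇒m%n≡m (s≤s i<m)))
... | inj₂ (i≡m , eq)  = trans eq (sym (trans (cong (λ t → suc t % suc m) i≡m) (n%n≡0 (suc m))))

next-mod : ∀ m k → next (k mod suc m) ≡ suc k mod suc m
next-mod m k = toℕ-injective (begin
  toℕ (next (k mod n))         ≡⟨ toℕ-next (k mod n) ⟩
  suc (toℕ (k mod n)) % n      ≡⟨ cong (λ t → suc t % n) (toℕ-fromℕ< _) ⟩
  (1 + k % n) % n              ≡⟨ %-distribˡ-+ 1 (k % n) n ⟩
  (1 % n + k % n % n) % n      ≡⟨ cong (λ t → (1 % n + t) % n) (m%n%n≡m%n k n) ⟩
  (1 % n + k % n) % n          ≡⟨ %-distribˡ-+ 1 k n ⟨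
  suc k % n                    ≡⟨ toℕ-fromℕ< _ ⟨
  toℕ (suc k mod n)            ∎)
  where open ≡-Reasoning
        n = suc m

module _ {U R : Set} (S : SStructure U R) {m : ℕ} (C : Cycle S (suc m)) where
  open SStructure S
  open Cycle C

  walk : ℕ → Carrier
  walk k = vertex (k mod suc m)

  walk-adjacent : ∀ k → GAdj S (walk k) (walk (suc k))
  walk-adjacent k = subst (GAdj S (walk k) ∘ vertex) (next-mod m k) (adjacent (k mod suc m))

  walk-injective : ∀ {i j} → i < suc m → j < suc m → walk i ≈ walk j → i ≡ j
  walk-injective {i} {j} i<n j<n eq = begin
    i                  ≡⟨ m<n⇒m%n≡m i<n ⟨
    i % suc m          ≡⟨ toℕ-fromℕ< _ ⟨
    toℕ (i mod suc m)  ≡⟨ cong toℕ (distinct _ _ eq) ⟩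
    toℕ (j mod suc m)  ≡⟨ toℕ-fromℕ< _ ⟩
    j % suc m          ≡⟨ m<n⇒m%n≡m j<n ⟩
    j                  ∎
    where open ≡-Reasoning

  walk-closes : walk (suc m) ≡ walk 0
  walk-closes = cong vertex (toℕ-injective (trans (toℕ-fromℕ< _) (n%n≡0 (suc m))))

module _ {U R : Set} (A : Structure U R) where
  open Structure A

  private
    Adj : Carrier → Carrier → Set
    Adj = GAdj (toS A)

  closedWalk⇒cycle : ∀ {L} (v : ℕ → Carrier) → 3 ≤ L →
    (∀ k → k < L → Adj (v k) (v (suc k))) → v L ≡ v 0 →
    (∀ {i j} → i < L → j < L → v i ≡ v j → i ≡ j) → Cycle (toS A) L
  closedWalk⇒cycle {suc l} v 3≤L adj closes inj = record
    { long     = 3≤L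
    ; vertex   = v ∘ toℕ
    ; distinct = λ i j eq → toℕ-injective (inj (toℕ<n i) (toℕ<n j) eq)
    ; adjacent = adjacent
    }
    where
    adjacent : ∀ i → Adj (v (toℕ i)) (v (toℕ (next i)))
    adjacent i with toℕ-sucMod i
    ... | inj₁ (_ , eq)   = subst (Adj (v (toℕ i)) ∘ v) (sym eq) (adj (toℕ i) (toℕ<n i))
    ... | inj₂ (i≡l , eq) = subst (Adj (v (toℕ i)) ∘ v) (sym eq)
                              (subst (Adj (v (toℕ i))) (trans (cong (v ∘ suc) i≡l) closes) (adj (toℕ i) (toℕ<n i)))

  nonBacktracking⇒injective : ∀ (v : ℕ → Carrier) N →
    (∀ k → k < N → Adj (v k) (v (suc k))) →
    (∀ k → 2 + k ≤ N → v k ≢ v (2 + k)) →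
    (∀ L → L ≤ N → ¬ Cycle (toS A) L) →
    ∀ {i j} → i ≤ N → j ≤ N → v i ≡ v j → i ≡ j
  nonBacktracking⇒injective v N adj nonBacktracking noCycle = injectiveUpTo N ≤-refl
    where
    InjectiveUpTo : ℕ → Set
    InjectiveUpTo j = ∀ {p q} → p ≤ j → q ≤ j → v p ≡ v q → p ≡ q

    noReturn : ∀ L p → L + p < N → InjectiveUpTo (L + p) → v p ≢ v (suc (L + p))
    noReturn zero p lt _ = proj₁ (adj p lt)
    noReturn (suc zero) p lt _ = nonBacktracking p lt
    noReturn L@(suc (suc _)) p lt inj eq = noCycle (suc L) (≤-trans (s≤s (m≤m+n L p)) lt) cycle
      where
      cycle : Cycle (toS A) (suc L)
      cycle = closedWalk⇒cycle (λ k → v (k + p)) (s≤s (s≤s (s≤s z≤n)))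
        (λ k k≤L → adj (k + p) (≤-<-trans (+-monoˡ-≤ p (≤-pred k≤L)) lt))
        (sym eq)
        (λ i≤L j≤L eq′ → +-cancelʳ-≡ p _ _ (inj (+-monoˡ-≤ p (≤-pred i≤L)) (+-monoˡ-≤ p (≤-pred j≤L)) eq′))

    returns : ∀ {j p} → j < N → InjectiveUpTo j → p ≤ j → v p ≢ v (suc j)
    returns {j} {p} j<N inj p≤j with j ∸ p | m∸n+n≡m p≤j
    ... | L | refl = noReturn L p j<N inj

    injectiveUpTo : ∀ j → j ≤ N → InjectiveUpTo j
    injectiveUpTo zero _ z≤n z≤n _ = refl
    injectiveUpTo (suc j) j<N p≤ q≤ eq with m≤n⇒m<n∨m≡n p≤ | m≤n⇒m<n∨m≡n q≤
    ... | inj₁ p<   | inj₁ q<   = injectiveUpTo j (<⇒≤ j<N) (≤-pred p<) (≤-pred q<) eq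
    ... | inj₂ p≡   | inj₂ q≡   = trans p≡ (sym q≡)
    ... | inj₁ p<   | inj₂ refl = ⊥-elim (returns j<N (injectiveUpTo j (<⇒≤ j<N)) (≤-pred p<) eq)
    ... | inj₂ refl | inj₁ q<   = ⊥-elim (returns j<N (injectiveUpTo j (<⇒≤ j<N)) (≤-pred q<) (sym eq))

  private
    infix 4 _≈ᴸ_
    _≈ᴸ_ : Labeling A → Labeling A → Set
    _≈ᴸ_ = _≈L_ A

  flipAt-swap : ∀ {a b f g} → Adj a b → FlipAt A b a f g → FlipAt A a b f g
  flipAt-swap {a} {b} {f} {g} ab (off , flipped) = (λ x y xy → off x y xy ∘ (_∘ swap)) , (begin
    lab g a b        ≡⟨ lab-sym g a b ab ⟩
    lab g b a        ≡⟨ flipped ⟩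
    not (lab f b a)  ≡⟨ cong not (lab-sym f a b ab) ⟨
    not (lab f a b)  ∎)
    where open ≡-Reasoning

  flipAt-sym : ∀ {a b f g} → FlipAt A a b f g → FlipAt A a b g f
  flipAt-sym {a} {b} {f} {g} (off , flipped) =
    (λ x y xy → sym ∘ off x y xy) , sym (trans (cong not flipped) (not-involutive (lab f a b)))

  flipAt-cancel : ∀ {a b f g h} → Adj a b → FlipAt A a b f g → FlipAt A a b g h → f ≈ᴸ h
  -- SameEdge is undecidable, but an equation between booleans is stable under double negation.
  flipAt-cancel {a} {b} {f} {g} {h} ab (off₁ , flipped₁) (off₂ , flipped₂) x y xy =
    decidable-stable (lab f x y ≟ᴮ lab h x y) λ f≢h →
      f≢h (trans (off₁ x y xy (offEdge f≢h)) (off₂ x y xy (offEdge f≢h)))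
    where
    onEdge : lab f a b ≡ lab h a b
    onEdge = sym (begin
      lab h a b              ≡⟨ flipped₂ ⟩
      not (lab g a b)        ≡⟨ cong not flipped₁ ⟩
      not (not (lab f a b))  ≡⟨ not-involutive _ ⟩
      lab f a b              ∎)
      where open ≡-Reasoning

    offEdge : lab f x y ≢ lab h x y → ¬ SameEdge A x y a b
    offEdge f≢h (inj₁ (refl , refl)) = f≢h onEdge
    offEdge f≢h (inj₂ (refl , refl)) =
      f≢h (trans (lab-sym f b a xy) (trans onEdge (sym (lab-sym h b a xy))))

  pump-adjacent : ∀ {a b f g} → GAdj (pump A) (a , f) (b , g) → Adj a b × FlipAt A a b f g
  pump-adjacent (_ , r , inj₁ (inj₁ (a≢b , rab , flip))) = (a≢b , r , inj₁ rab) , flip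
  pump-adjacent (≉ , r , inj₁ (inj₂ (refl , f≈g , _)))   = ⊥-elim (≉ (refl , f≈g))
  pump-adjacent {f = f} {g} (_ , r , inj₂ (inj₁ (b≢a , rba , flip))) =
    ab , flipAt-swap {f = f} {g} ab (flipAt-sym {f = g} {f} flip)
    where
    ab : Adj _ _
    ab = b≢a ∘ sym , r , inj₂ rba
  pump-adjacent (≉ , r , inj₂ (inj₂ (refl , g≈f , _)))   = ⊥-elim (≉ (refl , λ x y xy → sym (g≈f x y xy)))

  pump-backtrack : ∀ {a b f g h} → GAdj (pump A) (a , f) (b , g) → GAdj (pump A) (b , g) (a , h) → f ≈ᴸ h
  pump-backtrack {f = f} {g} {h} there back with pump-adjacent {f = f} {g} there | pump-adjacent {f = g} {h} back
  ... | ab , flip | _ , flipBack = flipAt-cancel {f = f} {g} {h} ab flip (flipAt-swap {f = g} {h} ab flipBack)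

  lab-unflipped : ∀ (v : ℕ → Carrier) (F : ℕ → Labeling A) {x y} n → Adj x y →
    (∀ k → k < n → FlipAt A (v k) (v (suc k)) (F k) (F (suc k))) →
    (∀ k → k < n → ¬ SameEdge A x y (v k) (v (suc k))) →
    lab (F n) x y ≡ lab (F 0) x y
  lab-unflipped v F zero xy flips untouched = refl
  lab-unflipped v F {x} {y} (suc n) xy flips untouched = trans
    (sym (proj₁ (flips n ≤-refl) x y xy (untouched n ≤-refl)))
    (lab-unflipped v F n xy (λ k → flips k ∘ m<n⇒m<1+n) (λ k → untouched k ∘ m<n⇒m<1+n))

  pump-noCycle : ∀ {n} → (∀ L → L < n → ¬ Cycle (toS A) L) → ¬ Cycle (pump A) n
  pump-noCycle {zero} _ C with Cycle.long C
  ... | ()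
  pump-noCycle {suc m} noShortCycle C = not-¬ refl (begin
    lab (F 0) (a 0) (a 1)        ≡⟨ cong (λ f → lab f (a 0) (a 1)) closes ⟨
    lab (F (suc m)) (a 0) (a 1)  ≡⟨ lab-unflipped (a ∘ suc) (F ∘ suc) m (proj₁ (step 0))
                                      (λ k _ → proj₂ (step (suc k))) untouched ⟩
    lab (F 1) (a 0) (a 1)        ≡⟨ proj₂ (proj₂ (step 0)) ⟩
    not (lab (F 0) (a 0) (a 1))  ∎)
    where
    open ≡-Reasoning

    2≤m : 2 ≤ m
    2≤m = ≤-pred (Cycle.long C)

    a : ℕ → Carrier
    a = proj₁ ∘ walk (pump A) C

    F : ℕ → Labeling A
    F = proj₂ ∘ walk (pump A) C

    closes : F (suc m) ≡ F 0
    closes = cong proj₂ (walk-closes (pump A) C)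

    step : ∀ k → Adj (a k) (a (suc k)) × FlipAt A (a k) (a (suc k)) (F k) (F (suc k))
    step k = pump-adjacent {f = F k} {F (suc k)} (walk-adjacent (pump A) C k)

    nonBacktracking : ∀ k → 2 + k ≤ m → a k ≢ a (2 + k)
    nonBacktracking k 2+k≤m back = m≢1+n+m k (walk-injective (pump A) C k<n (s≤s 2+k≤m) (back , same))
      where
      k<n : k < suc m
      k<n = ≤-trans (m≤n+m (suc k) 1) (m≤n⇒m≤1+n 2+k≤m)

      same : F k ≈ᴸ F (2 + k)
      same = pump-backtrack {f = F k} {F (1 + k)} {F (2 + k)} (walk-adjacent (pump A) C k)
        (subst (λ c → GAdj (pump A) (walk (pump A) C (1 + k)) (c , F (2 + k))) (sym back)
          (walk-adjacent (pump A) C (1 + k)))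

    injective : ∀ {i j} → i ≤ m → j ≤ m → a i ≡ a j → i ≡ j
    injective = nonBacktracking⇒injective a m (λ k _ → proj₁ (step k)) nonBacktracking
                  (λ L L≤m → noShortCycle L (s≤s L≤m))

    untouched : ∀ k → k < m → ¬ SameEdge A (a 0) (a 1) (a (suc k)) (a (2 + k))
    untouched k k<m (inj₁ (a₀≡ , _)) with injective z≤n k<m a₀≡
    ... | ()
    untouched k k<m (inj₂ (a₀≡ , a₁≡)) with injective (≤-trans (s≤s z≤n) 2≤m) k<m a₁≡
    ... | refl with injective z≤n 2≤m a₀≡
    ...   | ()

  module _ (n : ℕ) (e : Fin n → Carrier) (surj : ∀ x → ∃ λ i → e i ≡ x) where
    private
      index : Carrier → Fin n
      index = proj₁ ∘ surj

      open Inverse 2↔Bool using () renaming (to to toBool; from to fromBool; strictlyInverseˡ to toBool-fromBool)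

    readBit : Fin (2 ^ (n * n)) → Carrier → Carrier → Bool
    readBit k x y = toBool (finToFun k (combine (index x) (index y)))

    decodeLabeling : Fin (2 ^ (n * n)) → Labeling A
    decodeLabeling k = record
      { lab     = λ x y → readBit k x y ∧ readBit k y x
      ; lab-sym = λ x y _ → ∧-comm (readBit k x y) (readBit k y x)
      }

    labelBits : Labeling A → Fin (n * n) → Fin 2
    labelBits f = fromBool ∘ uncurry (λ i j → lab f (e i) (e j)) ∘ remQuot n

    encodeLabeling : Labeling A → Fin (2 ^ (n * n))
    encodeLabeling = funToFin ∘ labelBits

    readBit-encode : ∀ f x y → readBit (encodeLabeling f) x y ≡ lab f x y
    readBit-encode f x y = begin
      toBool (finToFun (funToFin (labelBits f)) (combine i j))  ≡⟨ cong toBool (finToFun-funToFin (labelBits f) _) ⟩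
      toBool (labelBits f (combine i j))                        ≡⟨ cong (toBool ∘ fromBool ∘ uncurry (λ i j → lab f (e i) (e j)))
                                                                        (remQuot-combine i j) ⟩
      toBool (fromBool (lab f (e i) (e j)))                     ≡⟨ toBool-fromBool _ ⟩
      lab f (e i) (e j)                                         ≡⟨ cong₂ (lab f) (proj₂ (surj x)) (proj₂ (surj y)) ⟩
      lab f x y                                                 ∎
      where
      open ≡-Reasoning
      i = index x
      j = index y

    decode-encode : ∀ f → decodeLabeling (encodeLabeling f) ≈ᴸ f
    decode-encode f x y xy = begin
      readBit k x y ∧ readBit k y x  ≡⟨ cong₂ _∧_ (readBit-encode f x y) (readBit-encode f y x) ⟩
      lab f x y ∧ lab f y x          ≡⟨ cong (lab f x y ∧_) (lab-sym f x y xy) ⟨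
      lab f x y ∧ lab f x y          ≡⟨ ∧-idem (lab f x y) ⟩
      lab f x y                      ∎
      where
      open ≡-Reasoning
      k = encodeLabeling f

  pump-finite : IsFinite (toS A) → IsFinite (pump A)
  pump-finite (n , e , surj) = n * 2 ^ (n * n) , enumerate , covers
    where
    open SStructure (pump A) using (_≈_)

    pair : Fin n → Fin (2 ^ (n * n)) → Carrier × Labeling A
    pair i k = e i , decodeLabeling n e surj k

    enumerate : Fin (n * 2 ^ (n * n)) → Carrier × Labeling A
    enumerate = uncurry pair ∘ remQuot (2 ^ (n * n))

    covers : ∀ p → ∃ λ c → enumerate c ≈ p
    covers (x , f) = combine i k , subst (_≈ (x , f)) (cong (uncurry pair) (sym (remQuot-combine i k)))
                                     (proj₂ (surj x) , decode-encode n e surj f)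
      where
      i = proj₁ (surj x)
      k = encodeLabeling n e surj f

lemma24 : {U R : Set} (A : Structure U R) (g : ℕ) → IsGirth (toS A) g →
    GirthGreaterThan (pump A) g × (IsFinite (toS A) → IsFinite (pump A))
lemma24 A g (_ , minimal) = girth , pump-finite A
  where
  girth : GirthGreaterThan (pump A) g
  girth n n≤g = pump-noCycle A λ L L<n → minimal L (<-≤-trans L<n n≤g)
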